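{- Let $j$ and $h$ be positive integers, and for each integer $k$ let $f_{O_j,h}(k)$ be the number of $h$-element subsets $S\subseteq\{1,\ldots,j\}$ with $\sum_{n\in S}(2n-1)=kj$. Then $f_{O_j,h}(k)=f_{O_j,h}(2h-k)$ for all integers $k$ with $1\le k\le j-1$ and $1\le 2h-k\le j-1$; that is, the coefficients of $r_h(x)=\sum_{k=1}^{j-1}f_{O_j,h}(k)x^k$ are symmetric about the coefficient of $x^h$. -}

module Defs where

open import Data.Nat using (ℕ; zero; suc; _+_; _*_; _≟_)
open import Data.Bool using (Bool; true; false)
open import Data.Vec using (Vec; []; _∷_)
open import Data.List using (List; []; _∷_; map; _++_; length; filter)
open import Data.Product using (_×_)
open import Data.Fin using (Fin; toℕ)
open import Data.Fin.Subset using (Subset; ∣_∣)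
open import Relation.Nullary.Decidable using (_×-dec_)
open import Relation.Binary.PropositionalEquality using (_≡_)

allSubsets : (j : ℕ) → List (Subset j)
allSubsets zero = [] ∷ []
allSubsets (suc j) = map (true ∷_) (allSubsets j) ++ map (false ∷_) (allSubsets j)

-- Σ_{n ∈ S} (2n - 1), where element i : Fin j represents n = toℕ i + 1,
-- so 2n - 1 = 2 * toℕ i + 1.
oddSum : {j : ℕ} → Subset j → ℕ
oddSum {j} S = go 0 S
  where
  go : {m : ℕ} → ℕ → Vec Bool m → ℕ
  go i [] = 0
  go i (true ∷ v) = (2 * i + 1) + go (suc i) v
  go i (false ∷ v) = go (suc i) v

fO : (j h k : ℕ) → ℕ
fO j h k = length (filter (λ S → (∣ S ∣ ≟ h) ×-dec (oddSum S ≟ k * j)) (allSubsets j))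

{-# OPTIONS --safe #-}
-- Reversal S ↦ {j + 1 − n ∣ n ∈ S} preserves |S| and sends each odd number
-- 2n − 1 to 2j − (2n − 1), so it maps the h-subsets with odd-sum kj onto those
-- with odd-sum 2hj − kj = (2h − k)j. Since reversal permutes the subsets of
-- {1, …, j}, both counts agree.
module Submission where

open import Defs
open import Data.Bool using (Bool; true; false)
open import Data.Fin.Subset using (Subset; ∣_∣)
open import Data.List using (List; []; _∷_; _++_; map; filter; length)
open import Data.List.Properties using (length-++; filter-++; filter-≐)
open import Data.Nat using (ℕ; zero; suc; _+_; _*_; _∸_; _≤_; _≟_)
open import Data.Nat.Properties
  using ( +-commutativeSemigroup; +-identityʳ; +-suc; +-assoc; +-cancelˡ-≡; +-cancelʳ-≡
        ; m+[n∸m]≡n; *-distribʳ-+ )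
open import Algebra.Properties.CommutativeSemigroup +-commutativeSemigroup using (interchange)
open import Data.Nat.Tactic.RingSolver using (solve-∀)
open import Data.Product using (_×_; _,_)
open import Data.Vec using (Vec; []; _∷_; _∷ʳ_; [_]; reverse)
open import Data.Vec.Properties using (reverse-∷)
open import Function using (_∘_)
open import Level using (Level)
open import Relation.Binary.PropositionalEquality
  using (_≡_; refl; sym; trans; cong; cong₂; subst; module ≡-Reasoning)
open import Relation.Nullary using (does)
open import Relation.Nullary.Decidable using (_×-dec_)
open import Relation.Unary using (Pred; Decidable; _≐_)

private
  variable
    a ℓ ℓ′ : Level
    A B : Set a
    m j : ℕ

length-filter-map : {P : Pred B ℓ} (P? : Decidable P) (f : A → B) (xs : List A) →
                    length (filter P? (map f xs)) ≡ length (filter (P? ∘ f) xs)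
length-filter-map P? f [] = refl
length-filter-map P? f (x ∷ xs) with does (P? (f x))
... | true  = cong suc (length-filter-map P? f xs)
... | false = length-filter-map P? f xs

countSubsets : {P : Pred (Subset j) ℓ} → Decidable P → ℕ
countSubsets P? = length (filter P? (allSubsets _))

countSubsets-≐ : {P : Pred (Subset j) ℓ} {Q : Pred (Subset j) ℓ′} (P? : Decidable P) (Q? : Decidable Q) →
                 P ≐ Q → countSubsets P? ≡ countSubsets Q?
countSubsets-≐ P? Q? P≐Q = cong length (filter-≐ P? Q? P≐Q (allSubsets _))

countSubsets-∷ : {P : Pred (Subset (suc j)) ℓ} (P? : Decidable P) →
                 countSubsets P? ≡ countSubsets (P? ∘ (true ∷_)) + countSubsets (P? ∘ (false ∷_))
countSubsets-∷ {j} P? = begin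
  length (filter P? (map (true ∷_) Ss ++ map (false ∷_) Ss))
    ≡⟨ cong length (filter-++ P? (map (true ∷_) Ss) _) ⟩
  length (filter P? (map (true ∷_) Ss) ++ filter P? (map (false ∷_) Ss))
    ≡⟨ length-++ (filter P? (map (true ∷_) Ss)) ⟩
  length (filter P? (map (true ∷_) Ss)) + length (filter P? (map (false ∷_) Ss))
    ≡⟨ cong₂ _+_ (length-filter-map P? (true ∷_) Ss) (length-filter-map P? (false ∷_) Ss) ⟩
  countSubsets (P? ∘ (true ∷_)) + countSubsets (P? ∘ (false ∷_)) ∎
  where
  open ≡-Reasoning
  Ss = allSubsets j

countSubsets-∷ʳ : {P : Pred (Subset (suc j)) ℓ} (P? : Decidable P) →
                  countSubsets P? ≡ countSubsets (P? ∘ (_∷ʳ true)) + countSubsets (P? ∘ (_∷ʳ false))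
countSubsets-∷ʳ {zero} P? = trans (countSubsets-∷ P?) (cong₂ _+_ (∷≡∷ʳ true) (∷≡∷ʳ false))
  where
  ∷≡∷ʳ : ∀ b → countSubsets (P? ∘ (b ∷_)) ≡ countSubsets (P? ∘ (_∷ʳ b))
  ∷≡∷ʳ b = countSubsets-≐ (P? ∘ (b ∷_)) (P? ∘ (_∷ʳ b)) ((λ { {[]} p → p }) , (λ { {[]} p → p }))
countSubsets-∷ʳ {suc j} P? = begin
  countSubsets P?
    ≡⟨ countSubsets-∷ P? ⟩
  countSubsets (P? ∘ (true ∷_)) + countSubsets (P? ∘ (false ∷_))
    ≡⟨ cong₂ _+_ (countSubsets-∷ʳ (P? ∘ (true ∷_))) (countSubsets-∷ʳ (P? ∘ (false ∷_))) ⟩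
  (# true true + # true false) + (# false true + # false false)
    ≡⟨ interchange (# true true) _ _ _ ⟩
  (# true true + # false true) + (# true false + # false false)
    ≡⟨ sym (cong₂ _+_ (countSubsets-∷ (P? ∘ (_∷ʳ true))) (countSubsets-∷ (P? ∘ (_∷ʳ false)))) ⟩
  countSubsets (P? ∘ (_∷ʳ true)) + countSubsets (P? ∘ (_∷ʳ false)) ∎
  where
  open ≡-Reasoning
  # : Bool → Bool → ℕ
  # first last = countSubsets (λ (S : Subset j) → P? ((first ∷ S) ∷ʳ last))

countSubsets-reverse : {P : Pred (Subset j) ℓ} (P? : Decidable P) →
                       countSubsets (P? ∘ reverse) ≡ countSubsets P?
countSubsets-reverse {zero} P? = countSubsets-≐ (P? ∘ reverse) P? ((λ { {[]} p → p }) , (λ { {[]} p → p }))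
countSubsets-reverse {suc j} {P = P} P? = begin
  countSubsets (P? ∘ reverse)
    ≡⟨ countSubsets-∷ (P? ∘ reverse) ⟩
  countSubsets (P? ∘ reverse ∘ (true ∷_)) + countSubsets (P? ∘ reverse ∘ (false ∷_))
    ≡⟨ cong₂ _+_ (reverse-∷-≐ true) (reverse-∷-≐ false) ⟩
  countSubsets (P? ∘ (_∷ʳ true) ∘ reverse) + countSubsets (P? ∘ (_∷ʳ false) ∘ reverse)
    ≡⟨ cong₂ _+_ (countSubsets-reverse (P? ∘ (_∷ʳ true))) (countSubsets-reverse (P? ∘ (_∷ʳ false))) ⟩
  countSubsets (P? ∘ (_∷ʳ true)) + countSubsets (P? ∘ (_∷ʳ false))
    ≡⟨ sym (countSubsets-∷ʳ P?) ⟩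
  countSubsets P? ∎
  where
  open ≡-Reasoning
  reverse-∷-≐ : ∀ b → countSubsets (P? ∘ reverse ∘ (b ∷_)) ≡ countSubsets (P? ∘ (_∷ʳ b) ∘ reverse)
  reverse-∷-≐ b = countSubsets-≐ _ _
    ((λ {S} → subst P (reverse-∷ b S)) , (λ {S} → subst P (sym (reverse-∷ b S))))

∣x∷p∣≡∣[x]∣+∣p∣ : ∀ x (p : Subset m) → ∣ x ∷ p ∣ ≡ ∣ [ x ] ∣ + ∣ p ∣
∣x∷p∣≡∣[x]∣+∣p∣ true  p = refl
∣x∷p∣≡∣[x]∣+∣p∣ false p = refl

∣p∷ʳx∣≡∣[x]∣+∣p∣ : ∀ x (p : Subset m) → ∣ p ∷ʳ x ∣ ≡ ∣ [ x ] ∣ + ∣ p ∣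
∣p∷ʳx∣≡∣[x]∣+∣p∣ x []          = sym (+-identityʳ ∣ [ x ] ∣)
∣p∷ʳx∣≡∣[x]∣+∣p∣ x (true  ∷ p) = trans (cong suc (∣p∷ʳx∣≡∣[x]∣+∣p∣ x p)) (sym (+-suc ∣ [ x ] ∣ ∣ p ∣))
∣p∷ʳx∣≡∣[x]∣+∣p∣ x (false ∷ p) = ∣p∷ʳx∣≡∣[x]∣+∣p∣ x p

∣reverse-p∣≡∣p∣ : (p : Subset m) → ∣ reverse p ∣ ≡ ∣ p ∣
∣reverse-p∣≡∣p∣ []      = refl
∣reverse-p∣≡∣p∣ (x ∷ p) = begin
  ∣ reverse (x ∷ p) ∣     ≡⟨ cong ∣_∣ (reverse-∷ x p) ⟩
  ∣ reverse p ∷ʳ x ∣      ≡⟨ ∣p∷ʳx∣≡∣[x]∣+∣p∣ x (reverse p) ⟩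
  ∣ [ x ] ∣ + ∣ reverse p ∣ ≡⟨ cong (∣ [ x ] ∣ +_) (∣reverse-p∣≡∣p∣ p) ⟩
  ∣ [ x ] ∣ + ∣ p ∣         ≡⟨ sym (∣x∷p∣≡∣[x]∣+∣p∣ x p) ⟩
  ∣ x ∷ p ∣               ∎
  where open ≡-Reasoning

-- The helper go of oddSum is local to its where block; unifying against the
-- with-abstracted starting index brings it into scope as oddSumFrom.
mutual
  oddSumFrom : ℕ → Vec Bool m → ℕ
  oddSumFrom = _

  oddSum≡oddSumFrom-0 : (S : Subset j) → oddSum S ≡ oddSumFrom 0 S
  oddSum≡oddSumFrom-0 S with 0
  ... | _ = refl

oddSumFrom-∷ : ∀ i x (v : Vec Bool m) → oddSumFrom i (x ∷ v) ≡ oddSumFrom i [ x ] + oddSumFrom (suc i) v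
oddSumFrom-∷ i true  v = cong (_+ oddSumFrom (suc i) v) (sym (+-identityʳ (2 * i + 1)))
oddSumFrom-∷ i false v = refl

oddSumFrom-∷ʳ : ∀ i x (v : Vec Bool m) → oddSumFrom i (v ∷ʳ x) ≡ oddSumFrom i v + oddSumFrom (i + m) [ x ]
oddSumFrom-∷ʳ i x [] = cong (λ n → oddSumFrom n [ x ]) (sym (+-identityʳ i))
oddSumFrom-∷ʳ {suc m} i x (y ∷ v) = begin
  oddSumFrom i (y ∷ (v ∷ʳ x))
    ≡⟨ oddSumFrom-∷ i y (v ∷ʳ x) ⟩
  oddSumFrom i [ y ] + oddSumFrom (suc i) (v ∷ʳ x)
    ≡⟨ cong (oddSumFrom i [ y ] +_) (oddSumFrom-∷ʳ (suc i) x v) ⟩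
  oddSumFrom i [ y ] + (oddSumFrom (suc i) v + oddSumFrom (suc i + m) [ x ])
    ≡⟨ sym (+-assoc (oddSumFrom i [ y ]) _ _) ⟩
  oddSumFrom i [ y ] + oddSumFrom (suc i) v + oddSumFrom (suc i + m) [ x ]
    ≡⟨ cong₂ _+_ (sym (oddSumFrom-∷ i y v)) (cong (λ n → oddSumFrom n [ x ]) (sym (+-suc i m))) ⟩
  oddSumFrom i (y ∷ v) + oddSumFrom (i + suc m) [ x ] ∎
  where open ≡-Reasoning

oddSumFrom-+-[x] : ∀ i i′ x → oddSumFrom i [ x ] + oddSumFrom i′ [ x ] ≡ ∣ [ x ] ∣ * (2 * (i + i′ + 1))
oddSumFrom-+-[x] i i′ true  = pair i i′
  where
  pair : ∀ i i′ → (2 * i + 1 + 0) + (2 * i′ + 1 + 0) ≡ 1 * (2 * (i + i′ + 1))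
  pair = solve-∀
oddSumFrom-+-[x] i i′ false = refl

oddSumFrom-+-reverse : ∀ i i′ (v : Vec Bool m) →
                       oddSumFrom i v + oddSumFrom i′ (reverse v) ≡ ∣ v ∣ * (2 * (i + i′ + m))
oddSumFrom-+-reverse i i′ [] = refl
oddSumFrom-+-reverse {suc m} i i′ (x ∷ v) = begin
  oddSumFrom i (x ∷ v) + oddSumFrom i′ (reverse (x ∷ v))
    ≡⟨ cong₂ _+_ (oddSumFrom-∷ i x v)
                 (trans (cong (oddSumFrom i′) (reverse-∷ x v)) (oddSumFrom-∷ʳ i′ x (reverse v))) ⟩
  (first + rest) + (rest′ + first′)
    ≡⟨ interchange-outer first rest rest′ first′ ⟩
  (first + first′) + (rest + rest′)
    ≡⟨ cong₂ _+_ (oddSumFrom-+-[x] i (i′ + m) x) (oddSumFrom-+-reverse (suc i) i′ v) ⟩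
  ∣ [ x ] ∣ * (2 * (i + (i′ + m) + 1)) + ∣ v ∣ * (2 * (suc i + i′ + m))
    ≡⟨ regroup ∣ [ x ] ∣ ∣ v ∣ i i′ m ⟩
  (∣ [ x ] ∣ + ∣ v ∣) * (2 * (i + i′ + suc m))
    ≡⟨ cong (_* (2 * (i + i′ + suc m))) (sym (∣x∷p∣≡∣[x]∣+∣p∣ x v)) ⟩
  ∣ x ∷ v ∣ * (2 * (i + i′ + suc m)) ∎
  where
  open ≡-Reasoning
  first = oddSumFrom i [ x ]
  rest = oddSumFrom (suc i) v
  rest′ = oddSumFrom i′ (reverse v)
  first′ = oddSumFrom (i′ + m) [ x ]
  interchange-outer : ∀ a b c d → (a + b) + (c + d) ≡ (a + d) + (b + c)
  interchange-outer = solve-∀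
  regroup : ∀ s t i i′ m → s * (2 * (i + (i′ + m) + 1)) + t * (2 * (suc i + i′ + m))
                           ≡ (s + t) * (2 * (i + i′ + suc m))
  regroup = solve-∀

oddSum-+-reverse : (S : Subset j) → oddSum S + oddSum (reverse S) ≡ ∣ S ∣ * (2 * j)
oddSum-+-reverse S =
  trans (cong₂ _+_ (oddSum≡oddSumFrom-0 S) (oddSum≡oddSumFrom-0 (reverse S))) (oddSumFrom-+-reverse 0 0 S)

oddSum-reverse-≐ : ∀ {h a b} → a + b ≡ h * (2 * j) →
                   (λ (S : Subset j) → ∣ S ∣ ≡ h × oddSum S ≡ a) ≐
                   (λ (S : Subset j) → ∣ reverse S ∣ ≡ h × oddSum (reverse S) ≡ b)
oddSum-reverse-≐ {j} {h} {a} {b} a+b≡h*2j = (λ {S} → to S) , (λ {S} → from S)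
  where
  pairSum : ∀ S → ∣ S ∣ ≡ h → oddSum S + oddSum (reverse S) ≡ a + b
  pairSum S ∣S∣≡h = trans (oddSum-+-reverse S) (trans (cong (_* (2 * j)) ∣S∣≡h) (sym a+b≡h*2j))

  to : ∀ S → ∣ S ∣ ≡ h × oddSum S ≡ a → ∣ reverse S ∣ ≡ h × oddSum (reverse S) ≡ b
  to S (∣S∣≡h , refl) = trans (∣reverse-p∣≡∣p∣ S) ∣S∣≡h , +-cancelˡ-≡ a _ _ (pairSum S ∣S∣≡h)

  from : ∀ S → ∣ reverse S ∣ ≡ h × oddSum (reverse S) ≡ b → ∣ S ∣ ≡ h × oddSum S ≡ a
  from S (∣rS∣≡h , refl) = ∣S∣≡h , +-cancelʳ-≡ b _ _ (pairSum S ∣S∣≡h)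
    where ∣S∣≡h = trans (sym (∣reverse-p∣≡∣p∣ S)) ∣rS∣≡h

lemma5p2 : (j h : ℕ) → 1 ≤ j → 1 ≤ h → (k : ℕ) →
           1 ≤ k → k ≤ j ∸ 1 → k ≤ 2 * h → 1 ≤ 2 * h ∸ k → 2 * h ∸ k ≤ j ∸ 1 →
           fO j h k ≡ fO j h (2 * h ∸ k)
lemma5p2 j h _ _ k _ _ k≤2h _ _ = begin
  fO j h k
    ≡⟨ countSubsets-≐ (hasSizeAndOddSum? (k * j)) (hasSizeAndOddSum? (k′ * j) ∘ reverse)
                      (oddSum-reverse-≐ kj+k′j≡h*2j) ⟩
  countSubsets (hasSizeAndOddSum? (k′ * j) ∘ reverse)
    ≡⟨ countSubsets-reverse (hasSizeAndOddSum? (k′ * j)) ⟩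
  fO j h k′ ∎
  where
  open ≡-Reasoning
  k′ = 2 * h ∸ k

  hasSizeAndOddSum? : ∀ n → Decidable (λ (S : Subset j) → ∣ S ∣ ≡ h × oddSum S ≡ n)
  hasSizeAndOddSum? n S = (∣ S ∣ ≟ h) ×-dec (oddSum S ≟ n)

  kj+k′j≡h*2j : k * j + k′ * j ≡ h * (2 * j)
  kj+k′j≡h*2j = begin
    k * j + k′ * j   ≡⟨ sym (*-distribʳ-+ j k k′) ⟩
    (k + k′) * j     ≡⟨ cong (_* j) (m+[n∸m]≡n k≤2h) ⟩
    2 * h * j        ≡⟨ 2*h*j≡h*[2*j] h j ⟩
    h * (2 * j)      ∎
    where
    2*h*j≡h*[2*j] : ∀ h j → 2 * h * j ≡ h * (2 * j)
    2*h*j≡h*[2*j] = solve-∀
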